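{- Let $B$ be a non-trivial Boolean algebra and let $\mathscr K_{\min}=\{M\subseteq B: M\neq\emptyset \text{ and there is } x\in B\setminus\{0\} \text{ with } x\le m \text{ for all } m\in M\}$. Then $\mathscr K_{\min}$ is an ultracontact on $B$, and $\mathscr K_{\min}\subseteq\mathscr K$ for every ultracontact $\mathscr K$ on $B$.
   Context: Let $B$ be a non-trivial Boolean algebra with order $\le$ and join $+$. For $F,G\subseteq B$ put $F+G=\{f+g: f\in F,\ g\in G\}$, and write $F\preceq G$ iff for every $g\in G$ there is $f\in F$ with $f\le g$. An ultracontact on $B$ is a family $\mathscr K\subseteq 2^B$ such that for all $F,G\subseteq B$: (K0) $\emptyset\notin\mathscr K$; (K1) if $0\in F$ then $F\notin\mathscr K$; (K2) if $x\neq 0$ then $\{x\}\in\mathscr K$; (K3) if $F\preceq G$, $G\neq\emptyset$ and $F\in\mathscr K$, then $G\in\mathscr K$; (K4) if $F+G\in\mathscr K$ then $F\in\mathscr K$ or $G\in\mathscr K$. -}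

module Defs where

open import Level using (Level; _⊔_; suc)
open import Algebra.Lattice.Bundles using (BooleanAlgebra)
open import Data.Product using (Σ; _×_; ∃; ∃-syntax)
open import Data.Sum using (_⊎_)
open import Relation.Nullary using (¬_)
open import Relation.Unary using (Pred)

-- Subsets of B are predicates on the carrier at level c ⊔ ℓ
-- (large enough to contain singletons {x} = {y | y ≈ x}).
module UC {c ℓ : Level} (B : BooleanAlgebra c ℓ) where
  open BooleanAlgebra B hiding (¬_)

  Subset : Set (suc (c ⊔ ℓ))
  Subset = Pred Carrier (c ⊔ ℓ)

  _≤_ : Carrier → Carrier → Set ℓ
  x ≤ y = (x ∨ y) ≈ y

  NonTrivial : Set ℓ
  NonTrivial = ¬ (⊤ ≈ ⊥)

  ｛_｝ : Carrier → Subset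
  ｛ x ｝ = λ y → Level.Lift c (y ≈ x)

  IsEmpty : Subset → Set (c ⊔ ℓ)
  IsEmpty F = ∀ x → ¬ F x

  HasZero : Subset → Set (c ⊔ ℓ)
  HasZero F = ∃[ f ] (F f × f ≈ ⊥)

  _⊕_ : Subset → Subset → Subset
  (F ⊕ G) z = ∃[ f ] ∃[ g ] (F f × G g × z ≈ (f ∨ g))

  _⪯_ : Subset → Subset → Set (c ⊔ ℓ)
  F ⪯ G = ∀ g → G g → ∃[ f ] (F f × f ≤ g)

  Family : ∀ k → Set (c ⊔ suc (c ⊔ ℓ) ⊔ suc k)
  Family k = Pred Subset k

  record IsUltracontact {k : Level} (K : Family k) : Set (suc (c ⊔ ℓ) ⊔ k) where
    field
      K0 : ∀ F → IsEmpty F → ¬ K F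
      K1 : ∀ F → HasZero F → ¬ K F
      K2 : ∀ x → ¬ (x ≈ ⊥) → K ｛ x ｝
      K3 : ∀ F G → F ⪯ G → ¬ IsEmpty G → K F → K G
      K4 : ∀ F G → K (F ⊕ G) → K F ⊎ K G

  Kmin : Family (c ⊔ ℓ)
  Kmin M = ¬ IsEmpty M × ∃[ x ] (¬ (x ≈ ⊥) × (∀ m → M m → x ≤ m))

  _⊆ᶠ_ : ∀ {k k'} → Family k → Family k' → Set (suc (c ⊔ ℓ) ⊔ k ⊔ k')
  K ⊆ᶠ K' = ∀ M → K M → K' M

{-# OPTIONS --safe #-}
module Submission where

-- If x is a nonzero lower bound of M then {x} ⪯ M, so K2 and K3 put M into
-- every ultracontact.  For K4, let x ≤ f ∨ g for all f ∈ F and g ∈ G.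
-- Classically, either x ∧ ¬g ≠ 0 for some g ∈ G, and then
-- x ∧ ¬g is a nonzero lower bound of F, or x ∧ ¬g = 0, i.e. x ≤ g, for all g ∈ G.

open import Defs
open import Level using (Level; _⊔_; Lift; lift; lower)
open import Algebra.Lattice.Bundles using (BooleanAlgebra)
open import Axiom.ExcludedMiddle using (ExcludedMiddle)
open import Data.Product using (_×_; _,_; ∃-syntax)
open import Data.Sum using (_⊎_; inj₁; inj₂)
open import Function using (_∘_)
open import Relation.Nullary using (¬_; yes; no)
open import Relation.Nullary.Decidable using (map′; decidable-stable)
open import Relation.Nullary.Negation using (Stable)
import Algebra.Lattice.Properties.BooleanAlgebra as BooleanAlgebraProperties
import Algebra.Lattice.Properties.Lattice as LatticeProperties
import Relation.Binary.Lattice as OrderLattice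
import Relation.Binary.Lattice.Properties.JoinSemilattice as JoinSemilatticeProperties
import Relation.Binary.Lattice.Properties.MeetSemilattice as MeetSemilatticeProperties
import Relation.Binary.Reasoning.PartialOrder as ≤-Reasoning
import Relation.Binary.Reasoning.Setoid as ≈-Reasoning

module _ {c ℓ : Level} (B : BooleanAlgebra c ℓ) where
  open BooleanAlgebra B renaming (¬_ to ∁_)
  open BooleanAlgebraProperties B using (∨-identityʳ; ∧-identityʳ)
  open UC B

  -- x ⊑ y is the standard library's lattice order x ≈ x ∧ y.
  private
    open module L = OrderLattice.Lattice (LatticeProperties.∨-∧-orderTheoreticLattice lattice)
      using (poset; joinSemilattice; meetSemilattice; x≤x∨y; x∧y≤x)
      renaming (_≤_ to _⊑_)
    open JoinSemilatticeProperties joinSemilattice using (x≤y⇒x∨y≈y)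
    open MeetSemilatticeProperties meetSemilattice using (∧-monotonic)

  ⊑⇒≤ : ∀ {x y} → x ⊑ y → x ≤ y
  ⊑⇒≤ = x≤y⇒x∨y≈y

  ≤⇒⊑ : ∀ {x y} → x ≤ y → x ⊑ y
  ≤⇒⊑ {x} {y} x∨y≈y = L.≤-respʳ-≈ x∨y≈y (x≤x∨y x y)

  ≈⇒≤ : ∀ {x y} → x ≈ y → x ≤ y
  ≈⇒≤ = ⊑⇒≤ ∘ L.reflexive

  ≤-trans : ∀ {x y z} → x ≤ y → y ≤ z → x ≤ z
  ≤-trans x≤y y≤z = ⊑⇒≤ (L.trans (≤⇒⊑ x≤y) (≤⇒⊑ y≤z))

  x≤y≈⊥⇒x≈⊥ : ∀ {x y} → x ≤ y → y ≈ ⊥ → x ≈ ⊥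
  x≤y≈⊥⇒x≈⊥ {x} {y} x∨y≈y y≈⊥ = begin
    x      ≈⟨ ∨-identityʳ x ⟨
    x ∨ ⊥  ≈⟨ ∨-congˡ y≈⊥ ⟨
    x ∨ y  ≈⟨ x∨y≈y ⟩
    y      ≈⟨ y≈⊥ ⟩
    ⊥      ∎
    where open ≈-Reasoning setoid

  x≤y∨z⇒x∧∁z≤y : ∀ {x y z} → x ≤ (y ∨ z) → (x ∧ ∁ z) ≤ y
  x≤y∨z⇒x∧∁z≤y {x} {y} {z} x≤y∨z = ⊑⇒≤ (begin
    x ∧ ∁ z                ≤⟨ ∧-monotonic (≤⇒⊑ x≤y∨z) L.refl ⟩
    (y ∨ z) ∧ ∁ z          ≈⟨ ∧-distribʳ-∨ (∁ z) y z ⟩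
    (y ∧ ∁ z) ∨ (z ∧ ∁ z)  ≈⟨ ∨-congˡ (∧-complementʳ z) ⟩
    (y ∧ ∁ z) ∨ ⊥          ≈⟨ ∨-identityʳ _ ⟩
    y ∧ ∁ z                ≤⟨ x∧y≤x y (∁ z) ⟩
    y                      ∎)
    where open ≤-Reasoning poset

  x∧∁y≈⊥⇒x≤y : ∀ {x y} → x ∧ ∁ y ≈ ⊥ → x ≤ y
  x∧∁y≈⊥⇒x≤y {x} {y} x∧∁y≈⊥ = ⊑⇒≤ (begin
    x                      ≈⟨ ∧-identityʳ x ⟨
    x ∧ ⊤                  ≈⟨ ∧-congˡ (∨-complementʳ y) ⟨
    x ∧ (y ∨ ∁ y)          ≈⟨ ∧-distribˡ-∨ x y (∁ y) ⟩
    (x ∧ y) ∨ (x ∧ ∁ y)    ≈⟨ ∨-congˡ x∧∁y≈⊥ ⟩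
    (x ∧ y) ∨ ⊥            ≈⟨ ∨-identityʳ _ ⟩
    x ∧ y                  ∎)
    where open ≈-Reasoning setoid

  ≈-stable : ExcludedMiddle (c ⊔ ℓ) → ∀ {x y} → Stable (x ≈ y)
  ≈-stable em {x} {y} = decidable-stable (map′ lower lift (em {Lift c (x ≈ y)}))

  ⊕-emptyˡ : ∀ {F} G → IsEmpty F → IsEmpty (F ⊕ G)
  ⊕-emptyˡ G F-empty _ (f , _ , Ff , _) = F-empty f Ff

  ⊕-emptyʳ : ∀ F {G} → IsEmpty G → IsEmpty (F ⊕ G)
  ⊕-emptyʳ F G-empty _ (_ , g , _ , Gg , _) = G-empty g Gg

  Kmin-K4 : ExcludedMiddle (c ⊔ ℓ) → ∀ F G → Kmin (F ⊕ G) → Kmin F ⊎ Kmin G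
  Kmin-K4 em F G (F⊕G-nonempty , x , x≉⊥ , x≤F⊕G)
    with em {∃[ g ] (G g × ¬ (x ∧ ∁ g ≈ ⊥))}
  ... | yes (g , Gg , x∧∁g≉⊥) =
    inj₁ ( F⊕G-nonempty ∘ ⊕-emptyˡ G
         , x ∧ ∁ g , x∧∁g≉⊥
         , λ f Ff → x≤y∨z⇒x∧∁z≤y (x≤F⊕G (f ∨ g) (f , g , Ff , Gg , refl)))
  ... | no ∄g =
    inj₂ ( F⊕G-nonempty ∘ ⊕-emptyʳ F
         , x , x≉⊥
         , λ g Gg → x∧∁y≈⊥⇒x≤y (≈-stable em (λ x∧∁g≉⊥ → ∄g (g , Gg , x∧∁g≉⊥))))

  Kmin-isUltracontact : ExcludedMiddle (c ⊔ ℓ) → IsUltracontact Kmin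
  Kmin-isUltracontact em = record
    { K0 = λ { F F-empty (F-nonempty , _) → F-nonempty F-empty }
    ; K1 = λ { F (f , Ff , f≈⊥) (_ , x , x≉⊥ , x≤F) → x≉⊥ (x≤y≈⊥⇒x≈⊥ (x≤F f Ff) f≈⊥) }
    ; K2 = λ x x≉⊥ → (λ ｛x｝-empty → ｛x｝-empty x (lift refl))
                   , x , x≉⊥ , λ { _ (lift y≈x) → ≈⇒≤ (sym y≈x) }
    ; K3 = λ { F G F⪯G G-nonempty (_ , x , x≉⊥ , x≤F) →
               G-nonempty , x , x≉⊥
             , λ g Gg → let f , Ff , f≤g = F⪯G g Gg in ≤-trans (x≤F f Ff) f≤g }
    ; K4 = Kmin-K4 em
    }

  Kmin-least : ∀ {k} (K : Family k) → IsUltracontact K → Kmin ⊆ᶠ K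
  Kmin-least K isUltracontact M (M-nonempty , x , x≉⊥ , x≤M) =
    K3 ｛ x ｝ M (λ m Mm → x , lift refl , x≤M m Mm) M-nonempty (K2 x x≉⊥)
    where open IsUltracontact isUltracontact

theorem4p4 : ∀ {c ℓ k : Level} → ExcludedMiddle (c ⊔ ℓ) → (B : BooleanAlgebra c ℓ)
    → UC.NonTrivial B
    → UC.IsUltracontact B (UC.Kmin B)
      × (∀ (K : UC.Family B k) → UC.IsUltracontact B K → UC._⊆ᶠ_ B (UC.Kmin B) K)
theorem4p4 em B _ = Kmin-isUltracontact B em , Kmin-least B
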